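{- Let $\pi$ be a pattern, $k\ge 1$, and let $h$ be a non-erasing morphism such that $h(\pi)$ is a factor of $Z_k$. Let $\mathcal{V}_1$ be the set of variables $x$ of $\pi$ whose rank under $h$ equals $1$ (i.e. the maximal letter of $h(x)$ is $1$). Then $\mathcal{V}_1$ is a free set for $\pi$.
   Context: Zimin words: $Z_1=1$, $Z_k=Z_{k-1}\,k\,Z_{k-1}$. A pattern is a nonempty word over a finite set $V$ of variables; a non-erasing morphism $h$ maps each variable to a nonempty word over the positive integers. The rank of a variable $x$ under $h$ is the maximal letter occurring in $h(x)$. A set $F\subseteq V$ is a free set for $\pi$ if there exist sets $A,B\subseteq V$ with $F\subseteq B\setminus A$ such that for every factor $xy$ of $\pi$ consisting of two consecutive variables, $x\in A$ if and only if $y\in B$. -}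

module Defs where

open import Data.Nat using (ℕ; zero; suc; _⊔_; _≤_)
open import Data.List using (List; []; _∷_; _++_; [_]; foldr; concatMap)
open import Data.List.Membership.Propositional using (_∈_)
open import Data.List.Relation.Unary.All using (All)
open import Data.Fin using (Fin)
open import Data.Fin.Subset using (Subset; _∉_) renaming (_∈_ to _∈ₛ_)
open import Data.Product using (Σ; ∃; _×_; _,_)
open import Relation.Binary.PropositionalEquality using (_≡_)
open import Relation.Nullary using (¬_)
open import Function.Bundles using (_⇔_)

-- Words over positive integers are lists of ℕ (positivity imposed separately).
Word : Set
Word = List ℕ

-- Zimin words: Z₁ = 1, Z_k = Z_{k-1} k Z_{k-1}.  Z 0 = [] is a harmless
-- convention (the theorem assumes k ≥ 1).
Z : ℕ → Word
Z zero = []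
Z (suc zero) = 1 ∷ []
Z (suc (suc k)) = Z (suc k) ++ (suc (suc k) ∷ Z (suc k))

Factor : Word → Word → Set
Factor u w = Σ Word λ p → Σ Word λ s → p ++ u ++ s ≡ w

-- A pattern over n variables (variables are Fin n); nonemptiness is a hypothesis.
Pattern : ℕ → Set
Pattern n = List (Fin n)

NonEmpty : Word → Set
NonEmpty w = ¬ (w ≡ [])

Positive : Word → Set
Positive w = All (λ a → 1 ≤ a) w

NonErasing : {n : ℕ} → (Fin n → Word) → Set
NonErasing h = ∀ x → NonEmpty (h x) × Positive (h x)

apply : {n : ℕ} → (Fin n → Word) → Pattern n → Word
apply h π = concatMap h π

maxLetter : Word → ℕ
maxLetter = foldr _⊔_ 0

rank : {n : ℕ} → (Fin n → Word) → Fin n → ℕ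
rank h x = maxLetter (h x)

data Consecutive {n : ℕ} : Pattern n → Fin n → Fin n → Set where
  here  : ∀ {x y π} → Consecutive (x ∷ y ∷ π) x y
  there : ∀ {z x y π} → Consecutive π x y → Consecutive (z ∷ π) x y

FreeSet : {n : ℕ} → Pattern n → (Fin n → Set) → Set
FreeSet {n} π F =
  Σ (Subset n) λ A → Σ (Subset n) λ B →
    (∀ x → F x → (x ∈ₛ B × x ∉ A)) ×
    (∀ x y → Consecutive π x y → (x ∈ₛ A ⇔ y ∈ₛ B))

V₁ : {n : ℕ} → Pattern n → (Fin n → Word) → Fin n → Set
V₁ π h x = (x ∈ π) × (rank h x ≡ 1)

module Submission where

open import Defs
open import Data.Bool using (Bool; true; false; not)
open import Data.Empty using (⊥-elim)
open import Data.Fin using (Fin)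
open import Data.Fin.Subset using (Subset) renaming (_∈_ to _∈ₛ_)
open import Data.List using (List; []; _∷_; _++_; [_]; head; last)
open import Data.List.Relation.Unary.All as All using (All; []; _∷_)
open import Data.List.Relation.Unary.Linked using (Linked; []; [-]; _∷_; _∷′_; tail)
open import Data.List.Relation.Unary.Linked.Properties using (++⁺)
open import Data.Maybe using (just; maybe′)
open import Data.Maybe.Relation.Binary.Connected using (Connected; just)
open import Data.Nat using (ℕ; zero; suc; _≤_; _≡ᵇ_)
open import Data.Nat.Properties using (≤-antisym; m⊔n≤o⇒m≤o; m⊔n≤o⇒n≤o; ≤-reflexive)
open import Data.Product using (_×_; _,_; proj₁; proj₂)
open import Data.Vec using (tabulate)
open import Data.Vec.Properties using ([]=⇒lookup; lookup⇒[]=; lookup∘tabulate)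
open import Function.Bundles using (_⇔_; mk⇔; module Equivalence)
open Equivalence using (to; from)
open import Relation.Nullary using (¬_)
open import Relation.Binary.PropositionalEquality using (_≡_; refl; sym; trans; subst)

-- In Z_k the letter 1 alternates with letters greater than 1.  Hence for consecutive
-- variables x y of π, h(x) ends in 1 exactly when h(y) does not start with 1, so
-- A = {x | h(x) does not end in 1} and B = {y | h(y) starts with 1} make every
-- rank-1 variable free: its image consists of 1s only, so it lies in B and not in A.

∈-tabulate : ∀ {n} {f : Fin n → Bool} x → x ∈ₛ tabulate f ⇔ f x ≡ true
∈-tabulate {f = f} x = mk⇔
  (λ x∈ → trans (sym (lookup∘tabulate f x)) ([]=⇒lookup x∈))
  (λ fx → lookup⇒[]= x (tabulate f) (trans (lookup∘tabulate f x) fx))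

module _ {A : Set} {R : A → A → Set} where

  linked-++⁻ˡ : ∀ xs {ys} → Linked R (xs ++ ys) → Linked R xs
  linked-++⁻ˡ []           _        = []
  linked-++⁻ˡ (x ∷ [])     _        = [-]
  linked-++⁻ˡ (x ∷ y ∷ xs) (r ∷ rs) = r ∷ linked-++⁻ˡ (y ∷ xs) rs

  linked-++⁻ʳ : ∀ xs {ys} → Linked R (xs ++ ys) → Linked R ys
  linked-++⁻ʳ []       rs = rs
  linked-++⁻ʳ (x ∷ xs) rs = linked-++⁻ʳ xs (tail rs)

  linked-infix : ∀ xs {ys zs} → Linked R (xs ++ ys ++ zs) → Linked R ys
  linked-infix xs {ys} rs = linked-++⁻ˡ ys (linked-++⁻ʳ xs rs)

  connected-just : ∀ {ma mb a b} → ma ≡ just a → mb ≡ just b → R a b → Connected R ma mb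
  connected-just refl refl r = just r

module _ {A : Set} where

  head-++ : ∀ (xs : List A) {ys a} → head xs ≡ just a → head (xs ++ ys) ≡ just a
  head-++ (x ∷ xs) eq = eq

  last-++ : ∀ (xs : List A) {ys a} → last ys ≡ just a → last (xs ++ ys) ≡ just a
  last-++ []           eq = eq
  last-++ (x ∷ [])     {y ∷ ys} eq = eq
  last-++ (x ∷ y ∷ xs) eq = last-++ (y ∷ xs) eq

isOne : ℕ → Bool
isOne a = a ≡ᵇ 1

startsWithOne : Word → Bool
startsWithOne w = maybe′ isOne false (head w)

endsWithOne : Word → Bool
endsWithOne w = maybe′ isOne false (last w)

ExactlyOneIsOne : ℕ → ℕ → Set
ExactlyOneIsOne a b = not (isOne a) ≡ isOne b

head-Z : ∀ k → head (Z (suc k)) ≡ just 1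
head-Z zero    = refl
head-Z (suc k) = head-++ (Z (suc k)) (head-Z k)

last-Z : ∀ k → last (Z (suc k)) ≡ just 1
last-Z zero    = refl
last-Z (suc k) = last-++ (Z (suc k)) (last-++ [ suc (suc k) ] {Z (suc k)} (last-Z k))

Z-alternates : ∀ k → Linked ExactlyOneIsOne (Z k)
Z-alternates zero          = []
Z-alternates (suc zero)    = [-]
Z-alternates (suc (suc k)) =
  ++⁺ (Z-alternates (suc k))
      (connected-just (last-Z k) refl refl)
      (connected-just refl (head-Z k) refl ∷′ Z-alternates (suc k))

alternates-across-++ : ∀ u {v w} → NonEmpty u → NonEmpty v →
  Linked ExactlyOneIsOne (u ++ v ++ w) → not (endsWithOne u) ≡ startsWithOne v
alternates-across-++ []           u≢[] _    _        = ⊥-elim (u≢[] refl)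
alternates-across-++ (a ∷ [])     {[]} _ v≢[] _      = ⊥-elim (v≢[] refl)
alternates-across-++ (a ∷ [])     {b ∷ v} _ _ (r ∷ _) = r
alternates-across-++ (a ∷ a′ ∷ u) _ v≢[] rs          =
  alternates-across-++ (a′ ∷ u) (λ ()) v≢[] (tail rs)

consecutive-alternate : ∀ {n} {h : Fin n → Word} {π x y} → NonErasing h →
  Consecutive π x y → Linked ExactlyOneIsOne (apply h π) →
  not (endsWithOne (h x)) ≡ startsWithOne (h y)
consecutive-alternate {h = h} {x = x} {y} ne here rs =
  alternates-across-++ (h x) (proj₁ (ne x)) (proj₁ (ne y)) rs
consecutive-alternate {h = h} {z ∷ π} ne (there c) rs =
  consecutive-alternate ne c (linked-++⁻ʳ (h z) rs)

maxLetter≤⇒All≤ : ∀ w {m} → maxLetter w ≤ m → All (_≤ m) w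
maxLetter≤⇒All≤ []      _ = []
maxLetter≤⇒All≤ (a ∷ w) m≥ =
  m⊔n≤o⇒m≤o a (maxLetter w) m≥ ∷ maxLetter≤⇒All≤ w (m⊔n≤o⇒n≤o a (maxLetter w) m≥)

rank-one⇒all-ones : ∀ {w} → Positive w → maxLetter w ≡ 1 → All (_≡ 1) w
rank-one⇒all-ones {w} pos r =
  All.zipWith (λ (≤1 , 1≤) → ≤-antisym ≤1 1≤)
    (maxLetter≤⇒All≤ w (≤-reflexive r) , pos)

startsWithOne-ones : ∀ {w} → All (_≡ 1) w → NonEmpty w → startsWithOne w ≡ true
startsWithOne-ones []         w≢[] = ⊥-elim (w≢[] refl)
startsWithOne-ones (refl ∷ _) _    = refl

endsWithOne-ones : ∀ {w} → All (_≡ 1) w → NonEmpty w → endsWithOne w ≡ true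
endsWithOne-ones []           w≢[] = ⊥-elim (w≢[] refl)
endsWithOne-ones (refl ∷ [])  _    = refl
endsWithOne-ones (_ ∷ p ∷ ps) _    = endsWithOne-ones (p ∷ ps) (λ ())

mainTheorem3 : (n : ℕ) (π : Pattern n) (k : ℕ) (h : Fin n → Word) →
    ¬ (π ≡ []) → 1 ≤ k → NonErasing h → Factor (apply h π) (Z k) →
    FreeSet π (V₁ π h)
mainTheorem3 n π k h _ _ ne (p , s , factor) = A , B , rank-one-free , consecutive-iff
  where
  A B : Subset n
  A = tabulate (λ x → not (endsWithOne (h x)))
  B = tabulate (λ x → startsWithOne (h x))

  alternates : Linked ExactlyOneIsOne (apply h π)
  alternates = linked-infix p (subst (Linked ExactlyOneIsOne) (sym factor) (Z-alternates k))

  rank-one-free : ∀ x → V₁ π h x → x ∈ₛ B × ¬ (x ∈ₛ A)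
  rank-one-free x (_ , r) = from (∈-tabulate x) (startsWithOne-ones ones hx≢[]) , x∉A
    where
    hx≢[] : NonEmpty (h x)
    hx≢[] = proj₁ (ne x)
    ones : All (_≡ 1) (h x)
    ones = rank-one⇒all-ones (proj₂ (ne x)) r
    x∉A : ¬ (x ∈ₛ A)
    x∉A x∈A with endsWithOne (h x) | endsWithOne-ones ones hx≢[] | to (∈-tabulate x) x∈A
    ... | .true | refl | ()

  consecutive-iff : ∀ x y → Consecutive π x y → x ∈ₛ A ⇔ y ∈ₛ B
  consecutive-iff x y c = mk⇔
    (λ x∈A → from (∈-tabulate y) (trans (sym alt) (to (∈-tabulate x) x∈A)))
    (λ y∈B → from (∈-tabulate x) (trans alt (to (∈-tabulate y) y∈B)))
    where
    alt : not (endsWithOne (h x)) ≡ startsWithOne (h y)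
    alt = consecutive-alternate ne c alternates
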